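{- Let $k \ge 2$ be an integer, and let $G$ be a graph of order $n$ with $\beta^k(G) = \beta$. Then $\alpha(G) \le \frac{n}{\beta+1}$. Moreover, if $\beta \ge 1$, then $\alpha(G) \le \frac{n-\beta(k-1)}{\beta+1}$.
   Context: All graphs are finite and simple; $\alpha(G)$ is the independence number (size of a largest independent set). For $S\subseteq V(G)$, $\Lambda^k_G(S)$ is the set of vertices with at least $k$ neighbors in $S$, and $\beta^k(G)=\min\{|\Lambda^k_G(S)|/|S| : S\subseteq V(G),\ |S|\ge k,\ \Lambda^k_G(S)\ne V(G)\}$, with $\beta^k(G)=0$ if $|V(G)|<k$. -}

module Defs where

open import Data.Bool using (Bool; true; false; if_then_else_)
open import Data.Nat as ℕ using (ℕ; zero; suc; _≤ᵇ_)
open import Data.Fin using (Fin)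
open import Data.Fin.Subset using (Subset; inside; outside; _∈_; _∩_; ∣_∣; ⊤)
open import Data.Vec using (tabulate)
open import Data.Integer using (+_)
open import Data.Rational using (ℚ; _/_; 0ℚ; _≤_)
open import Data.Product using (Σ; _×_)
open import Data.Sum using (_⊎_)
open import Relation.Binary.PropositionalEquality using (_≡_; _≢_)

record Graph (n : ℕ) : Set where
  field
    adj   : Fin n → Fin n → Bool
    sym   : ∀ u v → adj u v ≡ adj v u
    irref : ∀ v → adj v v ≡ false
open Graph public

N : ∀ {n} → Graph n → Fin n → Subset n
N G v = tabulate (λ u → if adj G v u then inside else outside)

Λ : ∀ {n} → Graph n → ℕ → Subset n → Subset n
Λ G k S = tabulate (λ v → if k ≤ᵇ ∣ S ∩ N G v ∣ then inside else outside)

ℕtoℚ : ℕ → ℚ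
ℕtoℚ m = + m / 1

-- a / b as a rational; only used with b ≥ k ≥ 1 (the value at b = 0 is irrelevant)
ratio : ℕ → ℕ → ℚ
ratio a zero    = 0ℚ
ratio a (suc b) = + a / suc b

Admissible : ∀ {n} → Graph n → ℕ → Subset n → Set
Admissible G k S = (k ℕ.≤ ∣ S ∣) × (Λ G k S ≢ ⊤)

IsBeta : ∀ {n} → Graph n → ℕ → ℚ → Set
IsBeta {n} G k β =
  (n ℕ.< k × β ≡ 0ℚ)
  ⊎ (k ℕ.≤ n
     × Σ (Subset n) (λ S → Admissible G k S × β ≡ ratio ∣ Λ G k S ∣ ∣ S ∣)
     × (∀ S → Admissible G k S → β ≤ ratio ∣ Λ G k S ∣ ∣ S ∣))

Independent : ∀ {n} → Graph n → Subset n → Set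
Independent G I = ∀ u v → u ∈ I → v ∈ I → adj G u v ≡ false

IsIndependenceNumber : ∀ {n} → Graph n → ℕ → Set
IsIndependenceNumber {n} G a =
  Σ (Subset n) (λ I → Independent G I × ∣ I ∣ ≡ a)
  × (∀ I → Independent G I → ∣ I ∣ ℕ.≤ a)

{-# OPTIONS --safe #-}
module Submission where

-- Extend a maximum independent set I by k − 1 further vertices (all of V(G) if
-- there are fewer) to a set S.  A vertex of I has no neighbour in I, hence at
-- most k − 1 neighbours in S, so Λᵏ(S) avoids I.  Thus S is admissible and
-- β|S| ≤ |Λᵏ(S)| ≤ n − α; as |S| ≥ α this gives α(β + 1) ≤ n.  If β ≥ 1, then
-- S = V(G) would force n ≤ n − α, so |S| = α + k − 1, which gives the second bound.

open import Defs hiding (sym)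
open import Data.Nat as ℕ using (ℕ; zero; suc; z≤n; s≤s; _<_; _∸_) renaming (_≤_ to _≤ℕ_)
open import Data.Rational
  using (ℚ; _≤_; _*_; _+_; _-_; -_; 0ℚ; 1ℚ; mkℚ; toℚᵘ; *≤*; NonNegative; nonNegative)
open import Data.Product using (_×_; _,_; proj₁)

open import Data.Bool using (Bool; true; if_then_else_)
open import Data.Bool.Properties using (T-≡)
open import Data.Empty using (⊥-elim)
open import Data.Fin using (Fin; fromℕ<)
open import Data.Fin.Subset
  using (Subset; inside; outside; _∈_; _∉_; _⊆_; _∩_; ∁; ∣_∣; ⊤; ⁅_⁆; Nonempty)
open import Data.Fin.Subset.Properties
  using (∣p∣≤n; p⊆q⇒∣p∣≤∣q∣; ∣∁p∣≡n∸∣p∣; ∣⊤∣≡n; ∣⊥∣≡0; ∣⁅x⁆∣≡1; x∈⁅y⁆⇒x≡y;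
         x∉p⇒x∈∁p; x∈p∩q⁻; Empty-unique)
open import Data.Integer as ℤ using (+_)
import Data.Integer.Properties as ℤ
import Data.Nat.Properties as ℕ
open import Data.Nat.Coprimality using (1-coprimeTo)
import Data.Nat.Coprimality as Coprime
open import Data.Rational.Properties
import Data.Rational.Unnormalised as ℚᵘ
import Data.Rational.Unnormalised.Properties as ℚᵘ
open import Data.Rational.Solver using (module +-*-Solver)
open import Data.Sum using (_⊎_; inj₁; inj₂)
open import Data.Vec using ([]; _∷_; here; there; tabulate)
open import Data.Vec.Properties using ([]=⇒lookup; lookup∘tabulate)
open import Function.Bundles using (Equivalence)
open import Relation.Binary.PropositionalEquality
  using (_≡_; _≢_; refl; sym; trans; cong; cong₂; subst)
open import Relation.Nullary using (¬_)

private
  variable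
    n : ℕ

extend : ℕ → Subset n → Subset n
extend zero    p             = p
extend (suc m) []            = []
extend (suc m) (inside ∷ p)  = inside ∷ extend (suc m) p
extend (suc m) (outside ∷ p) = inside ∷ extend m p

⊆-extend : ∀ m (p : Subset n) → p ⊆ extend m p
⊆-extend zero    p             x∈p         = x∈p
⊆-extend (suc m) (inside ∷ p)  here        = here
⊆-extend (suc m) (inside ∷ p)  (there x∈p) = there (⊆-extend (suc m) p x∈p)
⊆-extend (suc m) (outside ∷ p) (there x∈p) = there (⊆-extend m p x∈p)

∣extend∣ : ∀ m (p : Subset n) → ∣ extend m p ∣ ≡ n ⊎ ∣ extend m p ∣ ≡ ∣ p ∣ ℕ.+ m
∣extend∣ zero    p  = inj₂ (sym (ℕ.+-identityʳ ∣ p ∣))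
∣extend∣ (suc m) [] = inj₁ refl
∣extend∣ (suc m) (inside ∷ p) with ∣extend∣ (suc m) p
... | inj₁ full = inj₁ (cong suc full)
... | inj₂ size = inj₂ (cong suc size)
∣extend∣ (suc m) (outside ∷ p) with ∣extend∣ m p
... | inj₁ full = inj₁ (cong suc full)
... | inj₂ size = inj₂ (trans (cong suc size) (sym (ℕ.+-suc ∣ p ∣ m)))

∣extend∩∣≤ : ∀ m (p q : Subset n) → ∣ extend m p ∩ q ∣ ≤ℕ ∣ p ∩ q ∣ ℕ.+ m
∣extend∩∣≤ zero    p             q             = ℕ.m≤m+n ∣ p ∩ q ∣ 0
∣extend∩∣≤ (suc m) []            []            = z≤n
∣extend∩∣≤ (suc m) (inside ∷ p)  (inside ∷ q)  = s≤s (∣extend∩∣≤ (suc m) p q)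
∣extend∩∣≤ (suc m) (inside ∷ p)  (outside ∷ q) = ∣extend∩∣≤ (suc m) p q
∣extend∩∣≤ (suc m) (outside ∷ p) (inside ∷ q)  =
  subst (suc ∣ extend m p ∩ q ∣ ≤ℕ_) (sym (ℕ.+-suc ∣ p ∩ q ∣ m)) (s≤s (∣extend∩∣≤ m p q))
∣extend∩∣≤ (suc m) (outside ∷ p) (outside ∷ q) =
  subst (∣ extend m p ∩ q ∣ ≤ℕ_) (sym (ℕ.+-suc ∣ p ∩ q ∣ m)) (ℕ.m≤n⇒m≤1+n (∣extend∩∣≤ m p q))

⊆∁⇒∣p∣+∣q∣≤n : {p q : Subset n} → p ⊆ ∁ q → ∣ p ∣ ℕ.+ ∣ q ∣ ≤ℕ n
⊆∁⇒∣p∣+∣q∣≤n {p = p} {q} p⊆∁q = ℕ.m≤o∸n⇒m+n≤o ∣ p ∣ (∣p∣≤n q)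
  (subst (∣ p ∣ ≤ℕ_) (∣∁p∣≡n∸∣p∣ q) (p⊆q⇒∣p∣≤∣q∣ p⊆∁q))

if-inside : ∀ b → (if b then inside else outside) ≡ inside → b ≡ true
if-inside true  _ = refl

∈-tabulate-if : (b : Fin n → Bool) {x : Fin n} →
                x ∈ tabulate (λ y → if b y then inside else outside) → b x ≡ true
∈-tabulate-if b {x} x∈ = if-inside (b x) (trans (sym (lookup∘tabulate _ x)) ([]=⇒lookup x∈))

∈N⇒adj : (G : Graph n) {v u : Fin n} → u ∈ N G v → adj G v u ≡ true
∈N⇒adj G {v} = ∈-tabulate-if (adj G v)

∈Λ⇒≤ : (G : Graph n) (k : ℕ) (S : Subset n) {v : Fin n} →
       v ∈ Λ G k S → k ≤ℕ ∣ S ∩ N G v ∣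
∈Λ⇒≤ G k S v∈Λ =
  ℕ.≤ᵇ⇒≤ k _ (Equivalence.from T-≡ (∈-tabulate-if (λ u → k ℕ.≤ᵇ ∣ S ∩ N G u ∣) v∈Λ))

⁅⁆-independent : (G : Graph n) (v : Fin n) → Independent G ⁅ v ⁆
⁅⁆-independent G v x y x∈ y∈ rewrite x∈⁅y⁆⇒x≡y v x∈ | x∈⁅y⁆⇒x≡y v y∈ = irref G v

independent-∣∩N∣≡0 : (G : Graph n) {I : Subset n} {v : Fin n} →
                     Independent G I → v ∈ I → ∣ I ∩ N G v ∣ ≡ 0
independent-∣∩N∣≡0 {n} G {I} {v} indep v∈I = trans (cong ∣_∣ (Empty-unique empty)) (∣⊥∣≡0 n)
  where
  empty : ¬ Nonempty (I ∩ N G v)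
  empty (u , u∈) with x∈p∩q⁻ I (N G v) u∈
  ... | u∈I , u∈N with trans (sym (∈N⇒adj G u∈N)) (indep v u v∈I u∈I)
  ... | ()

Λ-extend⊆∁ : (G : Graph n) (m : ℕ) {I : Subset n} →
             Independent G I → Λ G (suc m) (extend m I) ⊆ ∁ I
Λ-extend⊆∁ G m {I} indep {v} v∈Λ = x∉p⇒x∈∁p v∉I
  where
  v∉I : v ∉ I
  v∉I v∈I = ℕ.n≮n m (subst (λ c → suc m ≤ℕ c ℕ.+ m) (independent-∣∩N∣≡0 G indep v∈I)
    (ℕ.≤-trans (∈Λ⇒≤ G (suc m) (extend m I) v∈Λ) (∣extend∩∣≤ m I (N G v))))

extend-admissible : (G : Graph n) (m : ℕ) {I : Subset n} → Independent G I →
                    0 < ∣ I ∣ → suc m ≤ℕ n → Admissible G (suc m) (extend m I)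
extend-admissible {n} G m {I} indep 0<∣I∣ k≤n = k≤∣S∣ , Λ≢⊤
  where
  k≤∣S∣ : suc m ≤ℕ ∣ extend m I ∣
  k≤∣S∣ with ∣extend∣ m I
  ... | inj₁ full = subst (suc m ≤ℕ_) (sym full) k≤n
  ... | inj₂ size = subst (suc m ≤ℕ_) (sym size) (ℕ.+-monoˡ-≤ m 0<∣I∣)
  Λ≢⊤ : Λ G (suc m) (extend m I) ≢ ⊤
  Λ≢⊤ Λ≡⊤ = ℕ.<⇒≱ (ℕ.m<m+n n 0<∣I∣)
    (subst (λ c → c ℕ.+ ∣ I ∣ ≤ℕ n) (trans (cong ∣_∣ Λ≡⊤) (∣⊤∣≡n n))
      (⊆∁⇒∣p∣+∣q∣≤n (Λ-extend⊆∁ G m indep)))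

independence-number-pos : (G : Graph n) {a : ℕ} → 0 < n →
                          (∀ I → Independent G I → ∣ I ∣ ≤ℕ a) → 0 < a
independence-number-pos {n} G {a} 0<n maximal =
  subst (_≤ℕ a) (∣⁅x⁆∣≡1 v) (maximal ⁅ v ⁆ (⁅⁆-independent G v))
  where
  v : Fin n
  v = fromℕ< 0<n

ℕtoℚ≡mkℚ : ∀ m → ℕtoℚ m ≡ mkℚ (+ m) 0 (Coprime.sym (1-coprimeTo m))
ℕtoℚ≡mkℚ m = normalize-coprime (Coprime.sym (1-coprimeTo m))

ℕtoℚ-mono-≤ : ∀ {m n} → m ≤ℕ n → ℕtoℚ m ≤ ℕtoℚ n
ℕtoℚ-mono-≤ {m} {n} m≤n rewrite ℕtoℚ≡mkℚ m | ℕtoℚ≡mkℚ n =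
  *≤* (ℤ.*-monoʳ-≤-nonNeg (+ 1) (ℤ.+≤+ m≤n))

ℕtoℚ-cancel-≤ : ∀ {m n} → ℕtoℚ m ≤ ℕtoℚ n → m ≤ℕ n
ℕtoℚ-cancel-≤ {m} {n} m≤n rewrite ℕtoℚ≡mkℚ m | ℕtoℚ≡mkℚ n =
  ℤ.drop‿+≤+ (ℤ.*-cancelʳ-≤-pos (+ m) (+ n) (+ 1) (drop-*≤* m≤n))

ℕtoℚ-+ : ∀ m n → ℕtoℚ (m ℕ.+ n) ≡ ℕtoℚ m + ℕtoℚ n
ℕtoℚ-+ m n = trans (/-cong numerators refl) (sym (cong₂ _+_ (ℕtoℚ≡mkℚ m) (ℕtoℚ≡mkℚ n)))
  where
  numerators : + (m ℕ.+ n) ≡ + m ℤ.* + 1 ℤ.+ + n ℤ.* + 1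
  numerators = trans (ℤ.pos-+ m n)
    (sym (cong₂ ℤ._+_ (ℤ.*-identityʳ (+ m)) (ℤ.*-identityʳ (+ n))))

ℕtoℚ-nonNeg : ∀ m → NonNegative (ℕtoℚ m)
ℕtoℚ-nonNeg m = normalize-nonNeg m 1

ratio-nonNeg : ∀ a b → 0ℚ ≤ ratio a b
ratio-nonNeg a zero    = ≤-refl
ratio-nonNeg a (suc b) = nonNegative⁻¹ _ {{normalize-nonNeg a (suc b)}}

ratio*b≡a : ∀ a b → ratio a (suc b) * ℕtoℚ (suc b) ≡ ℕtoℚ a
ratio*b≡a a b = toℚᵘ-injective (begin
  toℚᵘ (ratio a (suc b) * ℕtoℚ (suc b))
    ≈⟨ toℚᵘ-homo-* (ratio a (suc b)) (ℕtoℚ (suc b)) ⟩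
  toℚᵘ (ratio a (suc b)) ℚᵘ.* toℚᵘ (ℕtoℚ (suc b))
    ≈⟨ ℚᵘ.*-cong (toℚᵘ-fromℚᵘ a/b) (toℚᵘ-fromℚᵘ b/1) ⟩
  a/b ℚᵘ.* b/1
    ≈⟨ cancel ⟩
  a/1
    ≈⟨ toℚᵘ-fromℚᵘ a/1 ⟨
  toℚᵘ (ℕtoℚ a) ∎)
  where
  open ℚᵘ.≃-Reasoning
  a/b b/1 a/1 : ℚᵘ.ℚᵘ
  a/b = ℚᵘ.mkℚᵘ (+ a) b
  b/1 = ℚᵘ.mkℚᵘ (+ suc b) 0
  a/1 = ℚᵘ.mkℚᵘ (+ a) 0
  cancel : a/b ℚᵘ.* b/1 ℚᵘ.≃ a/1
  cancel = ℚᵘ.*≡* (trans (ℤ.*-identityʳ _)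
    (cong (λ d → + a ℤ.* + d) (sym (ℕ.*-identityʳ (suc b)))))

≤ratio⇒*≤ : ∀ {β} a b → 0 < b → β ≤ ratio a b → β * ℕtoℚ b ≤ ℕtoℚ a
≤ratio⇒*≤ {β} a (suc b) _ β≤ratio = subst (β * ℕtoℚ (suc b) ≤_) (ratio*b≡a a b)
  (*-monoʳ-≤-nonNeg (ℕtoℚ (suc b)) {{ℕtoℚ-nonNeg (suc b)}} β≤ratio)

module FromRatioBound {β : ℚ} (0≤β : 0ℚ ≤ β) {s L a n : ℕ}
         (βs≤L : β * ℕtoℚ s ≤ ℕtoℚ L) (L+a≤n : L ℕ.+ a ≤ℕ n) where

  open ≤-Reasoning
  open +-*-Solver

  private instance
    β-nonNeg : NonNegative β
    β-nonNeg = nonNegative 0≤β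

  βs+a≤n : β * ℕtoℚ s + ℕtoℚ a ≤ ℕtoℚ n
  βs+a≤n = begin
    β * ℕtoℚ s + ℕtoℚ a ≤⟨ +-monoˡ-≤ (ℕtoℚ a) βs≤L ⟩
    ℕtoℚ L + ℕtoℚ a     ≡⟨ ℕtoℚ-+ L a ⟨
    ℕtoℚ (L ℕ.+ a)      ≤⟨ ℕtoℚ-mono-≤ L+a≤n ⟩
    ℕtoℚ n              ∎

  a[β+1]≤n : a ≤ℕ s → ℕtoℚ a * (β + 1ℚ) ≤ ℕtoℚ n
  a[β+1]≤n a≤s = begin
    ℕtoℚ a * (β + 1ℚ)
      ≡⟨ solve 2 (λ a β → a :* (β :+ con 1ℚ) := β :* a :+ a) refl (ℕtoℚ a) β ⟩
    β * ℕtoℚ a + ℕtoℚ a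
      ≤⟨ +-monoˡ-≤ (ℕtoℚ a) (*-monoˡ-≤-nonNeg β (ℕtoℚ-mono-≤ a≤s)) ⟩
    β * ℕtoℚ s + ℕtoℚ a
      ≤⟨ βs+a≤n ⟩
    ℕtoℚ n ∎

  a[β+1]≤n-βm : ∀ {m} → s ≡ a ℕ.+ m → ℕtoℚ a * (β + 1ℚ) ≤ ℕtoℚ n - β * ℕtoℚ m
  a[β+1]≤n-βm {m} refl = begin
    ℕtoℚ a * (β + 1ℚ)
      ≡⟨ solve 3 (λ a m β → a :* (β :+ con 1ℚ) := β :* (a :+ m) :+ a :- β :* m) refl
               (ℕtoℚ a) (ℕtoℚ m) β ⟩
    β * (ℕtoℚ a + ℕtoℚ m) + ℕtoℚ a - β * ℕtoℚ m
      ≡⟨ cong (λ x → β * x + ℕtoℚ a - β * ℕtoℚ m) (ℕtoℚ-+ a m) ⟨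
    β * ℕtoℚ (a ℕ.+ m) + ℕtoℚ a - β * ℕtoℚ m
      ≤⟨ +-monoˡ-≤ (- (β * ℕtoℚ m)) βs+a≤n ⟩
    ℕtoℚ n - β * ℕtoℚ m ∎

  1≤β⇒s+a≤n : 1ℚ ≤ β → s ℕ.+ a ≤ℕ n
  1≤β⇒s+a≤n 1≤β = ℕtoℚ-cancel-≤ (begin
    ℕtoℚ (s ℕ.+ a)
      ≡⟨ ℕtoℚ-+ s a ⟩
    ℕtoℚ s + ℕtoℚ a
      ≡⟨ cong (_+ ℕtoℚ a) (*-identityˡ (ℕtoℚ s)) ⟨
    1ℚ * ℕtoℚ s + ℕtoℚ a
      ≤⟨ +-monoˡ-≤ (ℕtoℚ a) (*-monoʳ-≤-nonNeg (ℕtoℚ s) {{ℕtoℚ-nonNeg s}} 1≤β) ⟩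
    β * ℕtoℚ s + ℕtoℚ a
      ≤⟨ βs+a≤n ⟩
    ℕtoℚ n ∎)

proposition2p7 : (k n : ℕ) → 2 ≤ℕ k → (G : Graph n) → (β : ℚ) → (a : ℕ)
    → IsBeta G k β → IsIndependenceNumber G a
    → (ℕtoℚ a * (β + 1ℚ) ≤ ℕtoℚ n)
    × (1ℚ ≤ β → ℕtoℚ a * (β + 1ℚ) ≤ ℕtoℚ n - β * ℕtoℚ (k ∸ 1))
proposition2p7 zero _ () _ _ _ _ _
proposition2p7 (suc m) n _ G β _ (inj₁ (_ , refl)) ((I , _ , refl) , _) =
  a[β+1]≤n (∣p∣≤n I) , λ { (*≤* (ℤ.+≤+ ())) }
  where
  open FromRatioBound ≤-refl {n} {0} {∣ I ∣} (≤-reflexive (*-zeroˡ (ℕtoℚ n))) (∣p∣≤n I)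
proposition2p7 (suc m) n _ G β _
  (inj₂ (k≤n , (S₀ , _ , β≡ratio) , β-minimal)) ((I , indep , refl) , maximal) =
  a[β+1]≤n (p⊆q⇒∣p∣≤∣q∣ (⊆-extend m I)) , shifted
  where
  S : Subset n
  S = extend m I
  0<∣I∣ : 0 < ∣ I ∣
  0<∣I∣ = independence-number-pos G (ℕ.<-≤-trans ℕ.z<s k≤n) maximal
  0≤β : 0ℚ ≤ β
  0≤β = subst (0ℚ ≤_) (sym β≡ratio) (ratio-nonNeg ∣ Λ G (suc m) S₀ ∣ ∣ S₀ ∣)
  admissible : Admissible G (suc m) S
  admissible = extend-admissible G m indep 0<∣I∣ k≤n
  βs≤L : β * ℕtoℚ ∣ S ∣ ≤ ℕtoℚ ∣ Λ G (suc m) S ∣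
  βs≤L = ≤ratio⇒*≤ _ _ (ℕ.<-≤-trans ℕ.z<s (proj₁ admissible)) (β-minimal S admissible)
  L+a≤n : ∣ Λ G (suc m) S ∣ ℕ.+ ∣ I ∣ ≤ℕ n
  L+a≤n = ⊆∁⇒∣p∣+∣q∣≤n (Λ-extend⊆∁ G m indep)
  open FromRatioBound 0≤β {∣ S ∣} {∣ Λ G (suc m) S ∣} {∣ I ∣} βs≤L L+a≤n
  shifted : 1ℚ ≤ β → ℕtoℚ ∣ I ∣ * (β + 1ℚ) ≤ ℕtoℚ n - β * ℕtoℚ m
  shifted 1≤β with ∣extend∣ m I
  ... | inj₁ ∣S∣≡n     = ⊥-elim (ℕ.<⇒≱ (ℕ.m<m+n n 0<∣I∣)
                           (subst (λ c → c ℕ.+ ∣ I ∣ ≤ℕ n) ∣S∣≡n (1≤β⇒s+a≤n 1≤β)))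
  ... | inj₂ ∣S∣≡∣I∣+m = a[β+1]≤n-βm ∣S∣≡∣I∣+m
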